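{- Let $M$ be the distance matrix for the graph $G$ and let $N$ be the distance matrix for the graph $\displaystyle G\circ_{i=1}^\ell{}_{V_i}H_i$, then \[ N[i_1{:}j_1,i_2{:}j_2]= \begin{cases} M[i_1{:}1,i_2{:}1]+\alpha J&\text{if $i_1 \ne i_2$},\\ M[i_1{:}1,i_2{:}1]+\alpha J+(\beta-\alpha) I&\text{if $i_1 = i_2$}, \end{cases} \] where $\alpha=\dist_{H_{i_1}}(1,j_1)+\dist_{H_{i_2}}(1,j_2)$ and $\beta = \dist_{H_{i_1}}(j_1,j_2)$. (Recall that $1$ corresponds with the root of the corresponding $H_{i_k}$ on which we coalesce.)
   Context: All graphs are simple and undirected; $G$ and the rooted graphs $H_1,\ldots,H_\ell$ are connected. The distance matrix of a connected graph has $(u,v)$ entry $\dist(u,v)$, the length of a shortest $u$–$v$ path. Given a graph $G$ with a partition $V(G)=V_1\cup\cdots\cup V_\ell$ and rooted graphs $H_1,\ldots,H_\ell$, the coalescing $\displaystyle G\circ_{i=1}^\ell{}_{V_i}H_i$ is the graph obtained from the disjoint union of $G$ and, for each $i$ and each $v\in V_i$, a separate copy of $H_i$, by identifying the root of that copy of $H_i$ with $v$. Labeling: the vertices of $G$ are labeled $i{:}1{:}k$ (the $k$-th vertex of $V_i$); the vertices of $H_i$ are labeled $1,\ldots,|V(H_i)|$ with $1$ the root; in the coalesced graph $i{:}j{:}k$ denotes vertex $j$ of the copy of $H_i$ coalesced onto $i{:}1{:}k$. The block $i{:}j$ is the set $\{i{:}j{:}k\}$ over all $k$ (vertices ordered lexicographically).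 For a matrix $M$, $M[s,t]$ is the submatrix with rows in $s$ and columns in $t$; $I$ is the identity, $J$ the all-ones matrix (sizes from context). -}

module Defs where

open import Data.Nat using (ℕ; zero; suc; _≤_)
open import Data.Fin using (Fin; zero; suc)
open import Data.Product using (Σ; _×_; _,_; ∃)
open import Data.Integer using (ℤ; 0ℤ; 1ℤ)
open import Relation.Binary.PropositionalEquality using (_≡_)
open import Relation.Nullary using (¬_; yes; no)
open import Data.Fin using (_≟_)

record Graph (V : Set) : Set₁ where
  field
    Adj   : V → V → Set
    sym   : ∀ {u v} → Adj u v → Adj v u
    irrefl : ∀ {u} → ¬ Adj u u
open Graph public

data Walk {V : Set} (G : Graph V) : V → V → ℕ → Set where
  nil  : ∀ {u} → Walk G u u 0
  cons : ∀ {u w v n} → Adj G u w → Walk G w v n → Walk G u v (suc n)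

Connected : {V : Set} → Graph V → Set
Connected G = ∀ u v → ∃ λ n → Walk G u v n

IsDist : {V : Set} → Graph V → V → V → ℕ → Set
IsDist G u v d = Walk G u v d × (∀ n → Walk G u v n → d ≤ n)

-- Vertices of G labelled i:1:k, i ∈ Fin ℓ, k ∈ Fin (m i) (the k-th vertex of V_i).
GV : {ℓ : ℕ} → (Fin ℓ → ℕ) → Set
GV {ℓ} m = Σ (Fin ℓ) λ i → Fin (m i)

-- Vertices of the coalesced graph labelled i:j:k; H_i has vertex set
-- Fin (suc (h i)), the root (label 1) being zero.
CV : {ℓ : ℕ} → (Fin ℓ → ℕ) → (Fin ℓ → ℕ) → Set
CV {ℓ} m h = Σ (Fin ℓ) λ i → Fin (suc (h i)) × Fin (m i)

data CAdj {ℓ : ℕ} {m h : Fin ℓ → ℕ} (G : Graph (GV m))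
          (H : (i : Fin ℓ) → Graph (Fin (suc (h i)))) : CV m h → CV m h → Set where
  gEdge : ∀ {i k i' k'} → Adj G (i , k) (i' , k') →
          CAdj G H (i , zero , k) (i' , zero , k')
  hEdge : ∀ {i j j' k} → Adj (H i) j j' →
          CAdj G H (i , j , k) (i , j' , k)

coalesce : {ℓ : ℕ} {m h : Fin ℓ → ℕ} (G : Graph (GV m))
           (H : (i : Fin ℓ) → Graph (Fin (suc (h i)))) → Graph (CV m h)
coalesce {ℓ} {m} {h} G H = record { Adj = CAdj G H ; sym = s ; irrefl = ir }
  where
  s : ∀ {u v} → CAdj G H u v → CAdj G H v u
  s (gEdge e) = gEdge (sym G e)
  s (hEdge e) = hEdge (sym (H _) e)
  ir : ∀ {u} → ¬ CAdj G H u u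
  ir (gEdge e) = irrefl G e
  ir (hEdge e) = irrefl (H _) e

Iℤ : {n : ℕ} → Fin n → Fin n → ℤ
Iℤ k k' with k ≟ k'
... | yes _ = 1ℤ
... | no  _ = 0ℤ

{-# OPTIONS --safe #-}
-- A walk in the coalescing either stays inside one copy of some H_i, or it
-- leaves the copy it starts in, which is only possible through that copy's
-- root; it then walks in G from root to root and finally enters the target
-- copy through its root.  Hence the distance between vertices of different
-- copies is dist_H(j₁, root) + dist_G + dist_H(root, j₂), while inside a
-- single copy a detour through G cannot beat the direct path in H_i, since
-- both of its ends pass through the same root.
module Submission where

open import Defs
open import Data.Nat using (ℕ; suc; zero; _≤_; z≤n; s≤s)
import Data.Nat as ℕ using (_+_)
import Data.Nat.Properties as ℕₚ
open import Data.Fin using (Fin; zero) renaming (_≟_ to _≟ᶠ_)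
open import Data.Product using (_×_; _,_)
open import Data.Sum using (_⊎_; inj₁; inj₂)
import Data.Integer.Properties as ℤₚ
open import Data.Integer.Tactic.RingSolver using (solve-∀)
open import Data.Empty using (⊥-elim)
open import Relation.Nullary using (yes; no)
open import Relation.Binary.PropositionalEquality
  using (_≡_; _≢_; refl; cong; subst; module ≡-Reasoning)
  renaming (sym to ≡-sym; trans to ≡-trans)
open import Algebra.Properties.CommutativeSemigroup ℕₚ.+-commutativeSemigroup
  using (x∙yz≈y∙xz)

module _ {V : Set} {K : Graph V} where
  open Data.Nat using (_+_)

  _++ʷ_ : ∀ {u w v p q} → Walk K u w p → Walk K w v q → Walk K u v (p + q)
  nil      ++ʷ W′ = W′
  cons e W ++ʷ W′ = cons e (W ++ʷ W′)

  snocʷ : ∀ {u v w n} → Walk K u v n → Adj K v w → Walk K u w (suc n)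
  snocʷ nil        e = cons e nil
  snocʷ (cons e W) e′ = cons e (snocʷ W e′)

  reverseʷ : ∀ {u v n} → Walk K u v n → Walk K v u n
  reverseʷ nil        = nil
  reverseʷ (cons e W) = snocʷ (reverseʷ W) (sym K e)

  IsDist-unique : ∀ {u v m n} → IsDist K u v m → IsDist K u v n → m ≡ n
  IsDist-unique (Wm , m-min) (Wn , n-min) = ℕₚ.≤-antisym (m-min _ Wn) (n-min _ Wm)

  IsDist-self : ∀ {u d} → IsDist K u u d → d ≡ 0
  IsDist-self (_ , d-min) = ℕₚ.n≤0⇒n≡0 (d-min 0 nil)

mapʷ : ∀ {V W : Set} {K : Graph V} {L : Graph W} (f : V → W) →
       (∀ {u v} → Adj K u v → Adj L (f u) (f v)) →
       ∀ {u v n} → Walk K u v n → Walk L (f u) (f v) n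
mapʷ f f-adj nil        = nil
mapʷ f f-adj (cons e W) = cons (f-adj e) (mapʷ f f-adj W)

module Coalescing {ℓ : ℕ} {m h : Fin ℓ → ℕ} (G : Graph (GV m))
                  (H : (i : Fin ℓ) → Graph (Fin (suc (h i)))) where
  open Data.Nat using (_+_)

  C : Graph (CV m h)
  C = coalesce G H

  root : GV m → CV m h
  root (i , k) = i , zero , k

  baseWalk : ∀ {u v n} → Walk G u v n → Walk C (root u) (root v) n
  baseWalk = mapʷ root gEdge

  copyWalk : ∀ {i j j′ n} (k : Fin (m i)) → Walk (H i) j j′ n →
             Walk C (i , j , k) (i , j′ , k) n
  copyWalk {i} k = mapʷ (λ j → i , j , k) hEdge

  data InCopy : CV m h → CV m h → ℕ → Set where
    inCopy : ∀ {i j j′ k b n} → Walk (H i) j j′ b → b ≤ n →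
             InCopy (i , j , k) (i , j′ , k) n

  data ViaBase : CV m h → CV m h → ℕ → Set where
    viaBase : ∀ {i j k i′ j′ k′ p q r n} →
              Walk (H i) j zero p → Walk G (i , k) (i′ , k′) q →
              Walk (H i′) zero j′ r → p + q + r ≤ n →
              ViaBase (i , j , k) (i′ , j′ , k′) n

  walk-splits : ∀ {u v n} → Walk C u v n → InCopy u v n ⊎ ViaBase u v n
  walk-splits nil = inj₁ (inCopy nil z≤n)
  walk-splits (cons (gEdge g) W) with walk-splits W
  ... | inj₁ (inCopy w b≤n) = inj₂ (viaBase nil (cons g nil) w (s≤s b≤n))
  ... | inj₂ (viaBase {p = p} {q} {r} _ w₂ w₃ pqr≤n) =
    inj₂ (viaBase nil (cons g w₂) w₃
      (s≤s (ℕₚ.≤-trans (ℕₚ.+-monoˡ-≤ r (ℕₚ.m≤n+m q p)) pqr≤n)))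
  walk-splits (cons (hEdge a) W) with walk-splits W
  ... | inj₁ (inCopy w b≤n)           = inj₁ (inCopy (cons a w) (s≤s b≤n))
  ... | inj₂ (viaBase w₁ w₂ w₃ pqr≤n) = inj₂ (viaBase (cons a w₁) w₂ w₃ (s≤s pqr≤n))

  copy-dist : ∀ {i j₁ j₂ b} (k : Fin (m i)) → IsDist (H i) j₁ j₂ b →
              IsDist C (i , j₁ , k) (i , j₂ , k) b
  copy-dist {i} {j₁} {j₂} {b} k (w , b-min) = copyWalk k w , b≤
    where
    b≤ : ∀ n → Walk C (i , j₁ , k) (i , j₂ , k) n → b ≤ n
    b≤ n W with walk-splits W
    ... | inj₁ (inCopy w′ b′≤n) = ℕₚ.≤-trans (b-min _ w′) b′≤n
    ... | inj₂ (viaBase {p = p} {q} {r} w₁ _ w₃ pqr≤n) =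
      ℕₚ.≤-trans (b-min _ (w₁ ++ʷ w₃))
        (ℕₚ.≤-trans (ℕₚ.+-monoˡ-≤ r (ℕₚ.m≤m+n p q)) pqr≤n)

  cross-dist : ∀ {i₁ j₁ k₁ i₂ j₂ k₂ d a₁ a₂} →
               _≢_ {A = GV m} (i₁ , k₁) (i₂ , k₂) →
               IsDist G (i₁ , k₁) (i₂ , k₂) d →
               IsDist (H i₁) zero j₁ a₁ → IsDist (H i₂) zero j₂ a₂ →
               IsDist C (i₁ , j₁ , k₁) (i₂ , j₂ , k₂) (d + (a₁ + a₂))
  cross-dist {i₁} {j₁} {k₁} {i₂} {j₂} {k₂} {d} {a₁} {a₂} u≢v (g , d-min) (w₁ , a₁-min) (w₂ , a₂-min) =
    subst (Walk C _ _) (x∙yz≈y∙xz a₁ d a₂)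
      (copyWalk k₁ (reverseʷ w₁) ++ʷ (baseWalk g ++ʷ copyWalk k₂ w₂)) ,
    lower-bound
    where
    lower-bound : ∀ n → Walk C (i₁ , j₁ , k₁) (i₂ , j₂ , k₂) n → d + (a₁ + a₂) ≤ n
    lower-bound n W with walk-splits W
    ... | inj₁ (inCopy _ _) = ⊥-elim (u≢v refl)
    ... | inj₂ (viaBase {p = p} {q} {r} v₁ v₂ v₃ pqr≤n) = begin
      d + (a₁ + a₂) ≡⟨ ≡-sym (x∙yz≈y∙xz a₁ d a₂) ⟩
      a₁ + (d + a₂) ≡⟨ ≡-sym (ℕₚ.+-assoc a₁ d a₂) ⟩
      a₁ + d + a₂   ≤⟨ ℕₚ.+-mono-≤ (ℕₚ.+-mono-≤ (a₁-min p (reverseʷ v₁)) (d-min q v₂)) (a₂-min r v₃) ⟩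
      p + q + r     ≤⟨ pqr≤n ⟩
      n             ∎
      where open ℕₚ.≤-Reasoning

open import Data.Integer using (ℤ; +_; 0ℤ; 1ℤ; _+_; _-_; _*_)

0+x+[y-x]*1≡y : ∀ x y → 0ℤ + x + (y - x) * 1ℤ ≡ y
0+x+[y-x]*1≡y = solve-∀

x+y*0≡x : ∀ x y → x + y * 0ℤ ≡ x
x+y*0≡x x y = ≡-trans (cong (_+_ x) (ℤₚ.*-zeroʳ y)) (ℤₚ.+-identityʳ x)

pos-+-+ : ∀ d a₁ a₂ → + (d ℕ.+ (a₁ ℕ.+ a₂)) ≡ + d + (+ a₁ + + a₂)
pos-+-+ d a₁ a₂ = ≡-trans (ℤₚ.pos-+ d (a₁ ℕ.+ a₂)) (cong (_+_ (+ d)) (ℤₚ.pos-+ a₁ a₂))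

module DistanceMatrix {ℓ : ℕ} {m h : Fin ℓ → ℕ} (G : Graph (GV m))
                      (H : (i : Fin ℓ) → Graph (Fin (suc (h i)))) where
  open Coalescing G H

  distinct-copies-entry :
    ∀ {i₁ i₂ j₁ j₂ k₁ k₂ n d a₁ a₂} → _≢_ {A = GV m} (i₁ , k₁) (i₂ , k₂) →
    IsDist C (i₁ , j₁ , k₁) (i₂ , j₂ , k₂) n → IsDist G (i₁ , k₁) (i₂ , k₂) d →
    IsDist (H i₁) zero j₁ a₁ → IsDist (H i₂) zero j₂ a₂ →
    + n ≡ + d + (+ a₁ + + a₂)
  distinct-copies-entry {d = d} {a₁} {a₂} u≢v n-dist d-dist a₁-dist a₂-dist =
    ≡-trans (cong +_ (IsDist-unique n-dist (cross-dist u≢v d-dist a₁-dist a₂-dist)))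
            (pos-+-+ d a₁ a₂)

  same-copy-entry :
    ∀ {i j₁ j₂ k₁ k₂ n d a₁ a₂ b} →
    IsDist C (i , j₁ , k₁) (i , j₂ , k₂) n → IsDist G (i , k₁) (i , k₂) d →
    IsDist (H i) zero j₁ a₁ → IsDist (H i) zero j₂ a₂ → IsDist (H i) j₁ j₂ b →
    + n ≡ + d + (+ a₁ + + a₂) + (+ b - (+ a₁ + + a₂)) * Iℤ k₁ k₂
  same-copy-entry {k₁ = k₁} {k₂} {d = d} {a₁} {a₂} {b} n-dist d-dist a₁-dist a₂-dist b-dist
    with k₁ ≟ᶠ k₂
  ... | yes refl rewrite IsDist-self d-dist =
    ≡-trans (cong +_ (IsDist-unique n-dist (copy-dist k₁ b-dist)))
            (≡-sym (0+x+[y-x]*1≡y (+ a₁ + + a₂) (+ b)))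
  ... | no k₁≢k₂ =
    ≡-trans (distinct-copies-entry (λ where refl → k₁≢k₂ refl) n-dist d-dist a₁-dist a₂-dist)
            (≡-sym (x+y*0≡x (+ d + (+ a₁ + + a₂)) (+ b - (+ a₁ + + a₂))))

open DistanceMatrix

lemma2p2 : (ℓ : ℕ) (m h : Fin ℓ → ℕ) (G : Graph (GV m))
           (H : (i : Fin ℓ) → Graph (Fin (suc (h i)))) →
           Connected G → ((i : Fin ℓ) → Connected (H i)) →
           -- case i₁ ≠ i₂ : N[i₁:j₁,i₂:j₂] = M[i₁:1,i₂:1] + α J
           ((i₁ i₂ : Fin ℓ) → i₁ ≢ i₂ →
            (j₁ : Fin (suc (h i₁))) (j₂ : Fin (suc (h i₂)))
            (k₁ : Fin (m i₁)) (k₂ : Fin (m i₂)) (n d a₁ a₂ : ℕ) →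
            IsDist (coalesce G H) (i₁ , j₁ , k₁) (i₂ , j₂ , k₂) n →
            IsDist G (i₁ , k₁) (i₂ , k₂) d →
            IsDist (H i₁) zero j₁ a₁ →
            IsDist (H i₂) zero j₂ a₂ →
            (+ n) ≡ (+ d) + (+ a₁ + + a₂)) ×
           -- case i₁ = i₂ = i : N[i:j₁,i:j₂] = M[i:1,i:1] + α J + (β - α) I
           ((i : Fin ℓ) (j₁ j₂ : Fin (suc (h i))) (k₁ k₂ : Fin (m i))
            (n d a₁ a₂ b : ℕ) →
            IsDist (coalesce G H) (i , j₁ , k₁) (i , j₂ , k₂) n →
            IsDist G (i , k₁) (i , k₂) d →
            IsDist (H i) zero j₁ a₁ →
            IsDist (H i) zero j₂ a₂ →
            IsDist (H i) j₁ j₂ b →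
            (+ n) ≡ (+ d) + (+ a₁ + + a₂) + (+ b - (+ a₁ + + a₂)) * Iℤ k₁ k₂)
lemma2p2 ℓ m h G H _ _ =
  (λ i₁ i₂ i₁≢i₂ j₁ j₂ k₁ k₂ n d a₁ a₂ →
     distinct-copies-entry G H (λ where refl → i₁≢i₂ refl)) ,
  (λ i j₁ j₂ k₁ k₂ n d a₁ a₂ b → same-copy-entry G H)
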